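{- For all closed terms $P$ and $Q$ over $\Sigma_{CP}(A)$: if $P=_{st}Q$ then $\mathrm{CP}_{st}\vdash P=Q$.
   Context: Fix a finite non-empty set $A$ of atomic propositions. Closed terms are built from $T$, $F$, $a\in A$ by conditional composition $P\triangleleft Q\triangleright R$. $\mathrm{CP}_{st}$ consists of (CP1) $x\triangleleft T\triangleright y=x$, (CP2) $x\triangleleft F\triangleright y=y$, (CP3) $T\triangleleft x\triangleright F=x$, (CP4) $x\triangleleft(y\triangleleft z\triangleright u)\triangleright v=(x\triangleleft y\triangleright v)\triangleleft z\triangleright(x\triangleleft u\triangleright v)$, (CPstat) $(x\triangleleft y\triangleright z)\triangleleft u\triangleright v=(x\triangleleft u\triangleright v)\triangleleft y\triangleright(z\triangleleft u\triangleright v)$, (CPcontr) $(x\triangleleft y\triangleright z)\triangleleft y\triangleright u=x\triangleleft y\triangleright u$; $\vdash$ is equational derivability. A reactive valuation algebra (RVA) is a set $RV$ with elements $T_{RV},F_{RV}$ and for each $a\in A$ functions $y_a:RV\to\{T,F\}$, $\partial_a:RV\to RV$ with $y_a(T_{RV})=T$, $y_a(F_{RV})=F$, $\partial_a(T_{RV})=T_{RV}$, $\partial_a(F_{RV})=F_{RV}$. For closed $P$ and $H\in RV$: $T/H=T$, $F/H=F$, $a/H=y_a(H)$, $\partial_T(H)=\partial_F(H)=H$; $(P\triangleleft Q\triangleright R)/H=P/\partial_Q(H)$ and $\partial_{P\triangleleft Q\triangleright R}(H)=\partial_P(\partial_Q(H))$ if $Q/H=T$, and $R/\partial_Q(H)$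 resp. $\partial_R(\partial_Q(H))$ if $Q/H=F$. The variety $st$ is the class of RVAs with $y_a(\partial_b(H))=y_a(H)$ for all $a,b\in A$, $H$. $P\equiv_{st}Q$ means $P/H=Q/H$ for all RVAs in $st$ and all $H$; $=_{st}$ is the largest congruence (w.r.t. conditional composition) on closed terms contained in $\equiv_{st}$. -}

module Defs where

open import Data.Nat using (ℕ; suc)
open import Data.Fin using (Fin)
open import Data.Bool using (Bool; true; false)
open import Data.Product using (Σ; _×_)
open import Relation.Binary.PropositionalEquality using (_≡_)

-- The finite non-empty set of atoms: A = Fin (suc n).

data Term (n : ℕ) : Set where
  T F  : Term n
  atom : Fin (suc n) → Term n
  _◁_▷_ : Term n → Term n → Term n → Term n

infix 5 _◁_▷_

-- The equational theory CP_st; derivability of closed equations.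
-- Axiom instances are taken with closed terms substituted for the variables.
data _⊢st_≈_ {n : ℕ} : Term n → Term n → Set where
  refl′  : ∀ {x} → _⊢st_≈_ x x
  sym′   : ∀ {x y} → _⊢st_≈_ x y → _⊢st_≈_ y x
  trans′ : ∀ {x y z} → _⊢st_≈_ x y → _⊢st_≈_ y z → _⊢st_≈_ x z
  cong′  : ∀ {x x′ y y′ z z′} → _⊢st_≈_ x x′ → _⊢st_≈_ y y′ → _⊢st_≈_ z z′ →
           _⊢st_≈_ (x ◁ y ▷ z) (x′ ◁ y′ ▷ z′)
  CP1    : ∀ x y → _⊢st_≈_ (x ◁ T ▷ y) x
  CP2    : ∀ x y → _⊢st_≈_ (x ◁ F ▷ y) y
  CP3    : ∀ x → _⊢st_≈_ (T ◁ x ▷ F) x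
  CP4    : ∀ x y z u v →
           _⊢st_≈_ (x ◁ (y ◁ z ▷ u) ▷ v) ((x ◁ y ▷ v) ◁ z ▷ (x ◁ u ▷ v))
  CPstat : ∀ x y z u v →
           _⊢st_≈_ ((x ◁ y ▷ z) ◁ u ▷ v) ((x ◁ u ▷ v) ◁ y ▷ (z ◁ u ▷ v))
  CPcontr : ∀ x y z u →
           _⊢st_≈_ ((x ◁ y ▷ z) ◁ y ▷ u) (x ◁ y ▷ u)

CPst⊢_≈_ : {n : ℕ} → Term n → Term n → Set
CPst⊢ P ≈ Q = _⊢st_≈_ P Q

record RVA (n : ℕ) : Set₁ where
  field
    RV  : Set
    TRV FRV : RV
    y   : Fin (suc n) → RV → Bool
    ∂   : Fin (suc n) → RV → RV
    y-T : ∀ a → y a TRV ≡ true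
    y-F : ∀ a → y a FRV ≡ false
    ∂-T : ∀ a → ∂ a TRV ≡ TRV
    ∂-F : ∀ a → ∂ a FRV ≡ FRV

module _ {n : ℕ} (V : RVA n) where
  open RVA V

  mutual
    eval : Term n → RV → Bool
    eval T H = true
    eval F H = false
    eval (atom a) H = y a H
    eval (P ◁ Q ▷ R) H with eval Q H
    ... | true  = eval P (react Q H)
    ... | false = eval R (react Q H)

    react : Term n → RV → RV
    react T H = H
    react F H = H
    react (atom a) H = ∂ a H
    react (P ◁ Q ▷ R) H with eval Q H
    ... | true  = react P (react Q H)
    ... | false = react R (react Q H)

InSt : {n : ℕ} → RVA n → Set
InSt V = ∀ a b H → y a (∂ b H) ≡ y a H
  where open RVA V

_≡st_ : {n : ℕ} → Term n → Term n → Set₁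
_≡st_ {n} P Q = (V : RVA n) → InSt V → ∀ H → eval V P H ≡ eval V Q H

record IsCongruence {n : ℕ} (R : Term n → Term n → Set₁) : Set₁ where
  field
    rfl : ∀ {x} → R x x
    sy  : ∀ {x y} → R x y → R y x
    tr  : ∀ {x y z} → R x y → R y z → R x z
    cc  : ∀ {x x′ y y′ z z′} → R x x′ → R y y′ → R z z′ →
          R (x ◁ y ▷ z) (x′ ◁ y′ ▷ z′)

-- P =_st Q : related by the largest congruence contained in ≡_st, i.e. by
-- some congruence contained in ≡_st (the largest one contains all of them).
_=st_ : {n : ℕ} → Term n → Term n → Set₂
_=st_ {n} P Q = Σ (Term n → Term n → Set₁) λ R →
  IsCongruence R × (∀ {x y} → R x y → x ≡st y) × R P Q

-- Valuations with trivial reactions form an RVA in st, on which evaluation is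
-- ordinary propositional evaluation; so st-equivalent terms have the same
-- truth table. Conversely, CP_st proves the Shannon expansion
-- X ◁ a ▷ Y = X[a:=T] ◁ a ▷ Y[a:=F], so every term is provably equal to its
-- complete expansion over all atoms, which depends only on its truth table.
module Submission where

open import Data.Nat using (ℕ; suc)
open import Data.Fin using (Fin; _≟_)
open import Data.Bool using (Bool; true; false; if_then_else_)
open import Data.Product using (_×_; _,_)
open import Data.Unit using (⊤; tt)
open import Data.Empty using (⊥-elim)
open import Data.List using (List; []; _∷_; allFin)
open import Data.List.Membership.Propositional using (_∈_)
open import Data.List.Membership.Propositional.Properties using (∈-allFin)
open import Data.List.Relation.Unary.Any using (here; there)
open import Relation.Nullary using (yes; no)
open import Relation.Binary.Bundles using (Setoid)
open import Relation.Binary.PropositionalEquality using (_≡_; refl; sym; trans; cong; cong₂)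
import Relation.Binary.Reasoning.Setoid as SetoidReasoning
open import Defs

module _ {n : ℕ} where

  Atom : Set
  Atom = Fin (suc n)

  Valuation : Set
  Valuation = Atom → Bool

  ⟦_⟧ : Term n → Valuation → Bool
  ⟦ T ⟧ ρ = true
  ⟦ F ⟧ ρ = false
  ⟦ atom a ⟧ ρ = ρ a
  ⟦ P ◁ Q ▷ R ⟧ ρ = if ⟦ Q ⟧ ρ then ⟦ P ⟧ ρ else ⟦ R ⟧ ρ

  infix 4 _≗⟦⟧_
  infixl 9 _[_≔_] _[_↦_]

  _≗⟦⟧_ : Term n → Term n → Set
  P ≗⟦⟧ Q = ∀ ρ → ⟦ P ⟧ ρ ≡ ⟦ Q ⟧ ρ

  valuationRVA : RVA n
  valuationRVA = record
    { RV = Valuation ; TRV = λ _ → true ; FRV = λ _ → false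
    ; y = λ a ρ → ρ a ; ∂ = λ _ ρ → ρ
    ; y-T = λ _ → refl ; y-F = λ _ → refl ; ∂-T = λ _ → refl ; ∂-F = λ _ → refl }

  valuationRVA-inSt : InSt valuationRVA
  valuationRVA-inSt _ _ _ = refl

  mutual
    eval-valuationRVA : ∀ P ρ → eval valuationRVA P ρ ≡ ⟦ P ⟧ ρ
    eval-valuationRVA T ρ = refl
    eval-valuationRVA F ρ = refl
    eval-valuationRVA (atom a) ρ = refl
    eval-valuationRVA (P ◁ Q ▷ R) ρ
      with eval valuationRVA Q ρ | eval-valuationRVA Q ρ | react-valuationRVA Q ρ
    ... | true  | evalQ≡ | react≡ rewrite react≡ | sym evalQ≡ = eval-valuationRVA P ρ
    ... | false | evalQ≡ | react≡ rewrite react≡ | sym evalQ≡ = eval-valuationRVA R ρ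

    react-valuationRVA : ∀ P ρ → react valuationRVA P ρ ≡ ρ
    react-valuationRVA T ρ = refl
    react-valuationRVA F ρ = refl
    react-valuationRVA (atom a) ρ = refl
    react-valuationRVA (P ◁ Q ▷ R) ρ
      with eval valuationRVA Q ρ | react-valuationRVA Q ρ
    ... | true  | react≡ rewrite react≡ = react-valuationRVA P ρ
    ... | false | react≡ rewrite react≡ = react-valuationRVA R ρ

  ≡st⇒≗⟦⟧ : ∀ P Q → P ≡st Q → P ≗⟦⟧ Q
  ≡st⇒≗⟦⟧ P Q P≡Q ρ = begin
    ⟦ P ⟧ ρ                    ≡⟨ sym (eval-valuationRVA P ρ) ⟩
    eval valuationRVA P ρ      ≡⟨ P≡Q valuationRVA valuationRVA-inSt ρ ⟩
    eval valuationRVA Q ρ      ≡⟨ eval-valuationRVA Q ρ ⟩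
    ⟦ Q ⟧ ρ                    ∎
    where open Relation.Binary.PropositionalEquality.≡-Reasoning

  const : Bool → Term n
  const true = T
  const false = F

  ⟦const⟧ : ∀ c ρ → ⟦ const c ⟧ ρ ≡ c
  ⟦const⟧ true ρ = refl
  ⟦const⟧ false ρ = refl

  _[_≔_] : Term n → Atom → Bool → Term n
  T [ a ≔ c ] = T
  F [ a ≔ c ] = F
  atom b [ a ≔ c ] with b ≟ a
  ... | yes _ = const c
  ... | no _  = atom b
  (P ◁ Q ▷ R) [ a ≔ c ] = P [ a ≔ c ] ◁ Q [ a ≔ c ] ▷ R [ a ≔ c ]

  _[_↦_] : Valuation → Atom → Bool → Valuation
  (ρ [ a ↦ c ]) b with b ≟ a
  ... | yes _ = c
  ... | no _  = ρ b

  ⟦[≔]⟧ : ∀ P a c ρ → ⟦ P [ a ≔ c ] ⟧ ρ ≡ ⟦ P ⟧ (ρ [ a ↦ c ])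
  ⟦[≔]⟧ T a c ρ = refl
  ⟦[≔]⟧ F a c ρ = refl
  ⟦[≔]⟧ (atom b) a c ρ with b ≟ a
  ... | yes _ = ⟦const⟧ c ρ
  ... | no _  = refl
  ⟦[≔]⟧ (P ◁ Q ▷ R) a c ρ
    rewrite ⟦[≔]⟧ Q a c ρ | ⟦[≔]⟧ P a c ρ | ⟦[≔]⟧ R a c ρ = refl

  ≗⟦⟧-[≔] : ∀ P Q a c → P ≗⟦⟧ Q → P [ a ≔ c ] ≗⟦⟧ Q [ a ≔ c ]
  ≗⟦⟧-[≔] P Q a c P≗Q ρ =
    trans (⟦[≔]⟧ P a c ρ) (trans (P≗Q (ρ [ a ↦ c ])) (sym (⟦[≔]⟧ Q a c ρ)))

  -- The valuation at the leaves is arbitrary: once the list covers the atoms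
  -- of the term, the leaves are closed.
  expand : List Atom → Term n → Term n
  expand [] P = const (⟦ P ⟧ (λ _ → true))
  expand (a ∷ as) P = expand as (P [ a ≔ true ]) ◁ atom a ▷ expand as (P [ a ≔ false ])

  expand-≗⟦⟧ : ∀ as P Q → P ≗⟦⟧ Q → expand as P ≡ expand as Q
  expand-≗⟦⟧ [] P Q P≗Q = cong const (P≗Q _)
  expand-≗⟦⟧ (a ∷ as) P Q P≗Q =
    cong₂ (_◁ atom a ▷_) (expand-≗⟦⟧ as _ _ (≗⟦⟧-[≔] P Q a true P≗Q))
                         (expand-≗⟦⟧ as _ _ (≗⟦⟧-[≔] P Q a false P≗Q))

  ⊢-setoid : Setoid _ _
  ⊢-setoid = record
    { Carrier = Term n
    ; _≈_ = CPst⊢_≈_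
    ; isEquivalence = record { refl = refl′ ; sym = sym′ ; trans = trans′ } }

  open SetoidReasoning ⊢-setoid

  ◁-cong : ∀ {x x′ y z : Term n} → CPst⊢ x ≈ x′ → CPst⊢ (x ◁ y ▷ z) ≈ (x′ ◁ y ▷ z)
  ◁-cong x≈x′ = cong′ x≈x′ refl′ refl′

  ◁▷-cong : ∀ {x y y′ z : Term n} → CPst⊢ y ≈ y′ → CPst⊢ (x ◁ y ▷ z) ≈ (x ◁ y′ ▷ z)
  ◁▷-cong y≈y′ = cong′ refl′ y≈y′ refl′

  ▷-cong : ∀ {x y z z′ : Term n} → CPst⊢ z ≈ z′ → CPst⊢ (x ◁ y ▷ z) ≈ (x ◁ y ▷ z′)
  ▷-cong z≈z′ = cong′ refl′ refl′ z≈z′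

  ◁▷-idem : ∀ (x y : Term n) → CPst⊢ (x ◁ y ▷ x) ≈ x
  ◁▷-idem x y = begin
    x ◁ y ▷ x                          ≈⟨ cong′ (CP2 T x) refl′ (CP2 T x) ⟨
    (T ◁ F ▷ x) ◁ y ▷ (T ◁ F ▷ x)      ≈⟨ CPstat T y T F x ⟨
    (T ◁ y ▷ T) ◁ F ▷ x                ≈⟨ CP2 _ x ⟩
    x                                  ∎

  ◁¬▷ : ∀ (x y z : Term n) → CPst⊢ (x ◁ (F ◁ y ▷ T) ▷ z) ≈ (z ◁ y ▷ x)
  ◁¬▷ x y z = trans′ (CP4 x F y T z) (cong′ (CP2 x z) refl′ (CP1 x z))

  CPcontrʳ : ∀ (x y z u : Term n) → CPst⊢ (x ◁ y ▷ (z ◁ y ▷ u)) ≈ (x ◁ y ▷ u)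
  CPcontrʳ x y z u = begin
    x ◁ y ▷ (z ◁ y ▷ u)                    ≈⟨ ◁¬▷ _ y x ⟨
    (z ◁ y ▷ u) ◁ ¬y ▷ x                   ≈⟨ ◁-cong (◁¬▷ u y z) ⟨
    (u ◁ ¬y ▷ z) ◁ ¬y ▷ x                  ≈⟨ CPcontr u ¬y z x ⟩
    u ◁ ¬y ▷ x                             ≈⟨ ◁¬▷ u y x ⟩
    x ◁ y ▷ u                              ∎
    where ¬y = F ◁ y ▷ T

  CPstatʳ : ∀ (x y z u v : Term n) → CPst⊢ (x ◁ u ▷ (y ◁ z ▷ v)) ≈ ((x ◁ u ▷ y) ◁ z ▷ (x ◁ u ▷ v))
  CPstatʳ x y z u v = begin
    x ◁ u ▷ (y ◁ z ▷ v)                    ≈⟨ ◁¬▷ _ u x ⟨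
    (y ◁ z ▷ v) ◁ ¬u ▷ x                   ≈⟨ CPstat y z v ¬u x ⟩
    (y ◁ ¬u ▷ x) ◁ z ▷ (v ◁ ¬u ▷ x)        ≈⟨ cong′ (◁¬▷ y u x) refl′ (◁¬▷ v u x) ⟩
    (x ◁ u ▷ y) ◁ z ▷ (x ◁ u ▷ v)          ∎
    where ¬u = F ◁ u ▷ T

  ◁self▷ : ∀ (y z : Term n) → CPst⊢ (y ◁ y ▷ z) ≈ (T ◁ y ▷ z)
  ◁self▷ y z = trans′ (◁-cong (sym′ (CP3 y))) (CPcontr T y F z)

  ▷self : ∀ (x y : Term n) → CPst⊢ (x ◁ y ▷ y) ≈ (x ◁ y ▷ F)
  ▷self x y = trans′ (▷-cong (sym′ (CP3 y))) (CPcontrʳ x y T F)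

  guard-then : ∀ (x y z u v : Term n) →
    CPst⊢ ((x ◁ y ▷ z) ◁ u ▷ v) ≈ ((x ◁ (y ◁ u ▷ F) ▷ z) ◁ u ▷ v)
  guard-then x y z u v = begin
    (x ◁ y ▷ z) ◁ u ▷ v                        ≈⟨ CPcontr _ u (x ◁ F ▷ z) v ⟨
    ((x ◁ y ▷ z) ◁ u ▷ (x ◁ F ▷ z)) ◁ u ▷ v    ≈⟨ ◁-cong (CP4 x y u F z) ⟨
    (x ◁ (y ◁ u ▷ F) ▷ z) ◁ u ▷ v              ∎

  guard-else : ∀ (x y z u v : Term n) →
    CPst⊢ (x ◁ u ▷ (y ◁ z ▷ v)) ≈ (x ◁ u ▷ (y ◁ (T ◁ u ▷ z) ▷ v))
  guard-else x y z u v = begin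
    x ◁ u ▷ (y ◁ z ▷ v)                        ≈⟨ CPcontrʳ x u (y ◁ T ▷ v) _ ⟨
    x ◁ u ▷ ((y ◁ T ▷ v) ◁ u ▷ (y ◁ z ▷ v))    ≈⟨ ▷-cong (CP4 y T u z v) ⟨
    x ◁ u ▷ (y ◁ (T ◁ u ▷ z) ▷ v)              ∎

  [≔true]-then : ∀ a x y → CPst⊢ (x ◁ atom a ▷ y) ≈ (x [ a ≔ true ] ◁ atom a ▷ y)
  [≔true]-then a T y = refl′
  [≔true]-then a F y = refl′
  [≔true]-then a (atom b) y with b ≟ a
  ... | yes refl = ◁self▷ (atom b) y
  ... | no _     = refl′
  [≔true]-then a (p ◁ q ▷ r) y = begin
    (p ◁ q ▷ r) ◁ a′ ▷ y                  ≈⟨ CPstat p q r a′ y ⟩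
    (p ◁ a′ ▷ y) ◁ q ▷ (r ◁ a′ ▷ y)       ≈⟨ cong′ ([≔true]-then a p y) refl′ ([≔true]-then a r y) ⟩
    (p′ ◁ a′ ▷ y) ◁ q ▷ (r′ ◁ a′ ▷ y)     ≈⟨ CPstat p′ q r′ a′ y ⟨
    (p′ ◁ q ▷ r′) ◁ a′ ▷ y                ≈⟨ guard-then p′ q r′ a′ y ⟩
    (p′ ◁ (q ◁ a′ ▷ F) ▷ r′) ◁ a′ ▷ y     ≈⟨ ◁-cong (◁▷-cong ([≔true]-then a q F)) ⟩
    (p′ ◁ (q′ ◁ a′ ▷ F) ▷ r′) ◁ a′ ▷ y    ≈⟨ guard-then p′ q′ r′ a′ y ⟨
    (p′ ◁ q′ ▷ r′) ◁ a′ ▷ y               ∎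
    where
      a′ = atom a
      p′ = p [ a ≔ true ]
      q′ = q [ a ≔ true ]
      r′ = r [ a ≔ true ]

  [≔false]-else : ∀ a x y → CPst⊢ (x ◁ atom a ▷ y) ≈ (x ◁ atom a ▷ y [ a ≔ false ])
  [≔false]-else a x T = refl′
  [≔false]-else a x F = refl′
  [≔false]-else a x (atom b) with b ≟ a
  ... | yes refl = ▷self x (atom b)
  ... | no _     = refl′
  [≔false]-else a x (p ◁ q ▷ r) = begin
    x ◁ a′ ▷ (p ◁ q ▷ r)                  ≈⟨ CPstatʳ x p q a′ r ⟩
    (x ◁ a′ ▷ p) ◁ q ▷ (x ◁ a′ ▷ r)       ≈⟨ cong′ ([≔false]-else a x p) refl′ ([≔false]-else a x r) ⟩
    (x ◁ a′ ▷ p′) ◁ q ▷ (x ◁ a′ ▷ r′)     ≈⟨ CPstatʳ x p′ q a′ r′ ⟨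
    x ◁ a′ ▷ (p′ ◁ q ▷ r′)                ≈⟨ guard-else x p′ q a′ r′ ⟩
    x ◁ a′ ▷ (p′ ◁ (T ◁ a′ ▷ q) ▷ r′)     ≈⟨ ▷-cong (◁▷-cong ([≔false]-else a T q)) ⟩
    x ◁ a′ ▷ (p′ ◁ (T ◁ a′ ▷ q′) ▷ r′)    ≈⟨ guard-else x p′ q′ a′ r′ ⟨
    x ◁ a′ ▷ (p′ ◁ q′ ▷ r′)               ∎
    where
      a′ = atom a
      p′ = p [ a ≔ false ]
      q′ = q [ a ≔ false ]
      r′ = r [ a ≔ false ]

  shannon : ∀ a x → CPst⊢ x ≈ (x [ a ≔ true ] ◁ atom a ▷ x [ a ≔ false ])
  shannon a x = begin
    x                                        ≈⟨ ◁▷-idem x (atom a) ⟨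
    x ◁ atom a ▷ x                           ≈⟨ [≔true]-then a x x ⟩
    x [ a ≔ true ] ◁ atom a ▷ x              ≈⟨ [≔false]-else a _ x ⟩
    x [ a ≔ true ] ◁ atom a ▷ x [ a ≔ false ] ∎

  AtomsIn : List Atom → Term n → Set
  AtomsIn as T = ⊤
  AtomsIn as F = ⊤
  AtomsIn as (atom a) = a ∈ as
  AtomsIn as (P ◁ Q ▷ R) = AtomsIn as P × AtomsIn as Q × AtomsIn as R

  AtomsIn-const : ∀ as c → AtomsIn as (const c)
  AtomsIn-const as true = tt
  AtomsIn-const as false = tt

  AtomsIn-[≔] : ∀ a as c P → AtomsIn (a ∷ as) P → AtomsIn as (P [ a ≔ c ])
  AtomsIn-[≔] a as c T _ = tt
  AtomsIn-[≔] a as c F _ = tt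
  AtomsIn-[≔] a as c (atom b) b∈ with b ≟ a | b∈
  ... | yes _  | _         = AtomsIn-const as c
  ... | no b≢a | here b≡a  = ⊥-elim (b≢a b≡a)
  ... | no _   | there b∈′ = b∈′
  AtomsIn-[≔] a as c (P ◁ Q ▷ R) (inP , inQ , inR) =
    AtomsIn-[≔] a as c P inP , AtomsIn-[≔] a as c Q inQ , AtomsIn-[≔] a as c R inR

  AtomsIn-allFin : ∀ P → AtomsIn (allFin (suc n)) P
  AtomsIn-allFin T = tt
  AtomsIn-allFin F = tt
  AtomsIn-allFin (atom a) = ∈-allFin a
  AtomsIn-allFin (P ◁ Q ▷ R) = AtomsIn-allFin P , AtomsIn-allFin Q , AtomsIn-allFin R

  closed-≈const : ∀ P ρ → AtomsIn [] P → CPst⊢ P ≈ const (⟦ P ⟧ ρ)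
  closed-≈const T ρ _ = refl′
  closed-≈const F ρ _ = refl′
  closed-≈const (P ◁ Q ▷ R) ρ (inP , inQ , inR)
    with ⟦ Q ⟧ ρ | closed-≈const Q ρ inQ
  ... | true  | Q≈T = trans′ (◁▷-cong Q≈T) (trans′ (CP1 P R) (closed-≈const P ρ inP))
  ... | false | Q≈F = trans′ (◁▷-cong Q≈F) (trans′ (CP2 P R) (closed-≈const R ρ inR))

  ≈expand : ∀ as P → AtomsIn as P → CPst⊢ P ≈ expand as P
  ≈expand [] P inP = closed-≈const P _ inP
  ≈expand (a ∷ as) P inP = trans′ (shannon a P)
    (cong′ (≈expand as _ (AtomsIn-[≔] a as true P inP))
           refl′
           (≈expand as _ (AtomsIn-[≔] a as false P inP)))

  ≡st-complete : ∀ P Q → P ≡st Q → CPst⊢ P ≈ Q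
  ≡st-complete P Q P≡Q = begin
    P                ≈⟨ ≈expand atoms P (AtomsIn-allFin P) ⟩
    expand atoms P   ≡⟨ expand-≗⟦⟧ atoms P Q (≡st⇒≗⟦⟧ P Q P≡Q) ⟩
    expand atoms Q   ≈⟨ ≈expand atoms Q (AtomsIn-allFin Q) ⟨
    Q                ∎
    where atoms = allFin (suc n)

mainTheorem10 : (n : ℕ) (P Q : Term n) → P =st Q → CPst⊢ P ≈ Q
mainTheorem10 n P Q (_ , _ , ⊆≡st , PRQ) = ≡st-complete P Q (⊆≡st PRQ)
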